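{- Let $K(v)$ be a complete multipartite graph and $E$ a set of edges of $K(v)$. (1) If $\langle E\rangle$ contains a $\Xi_2$-subgraph, then the number of garlands does not exceed $3\cdot 2^{|E|-2} - 1$. (2) If $\langle E\rangle$ contains two distinct $\Xi_2$-subgraphs with edge sets $E_1$ and $E_2$, then the number of garlands does not exceed $2^{|E|-1} + 2^{|E| - |E_1\cup E_2|} - 1$.
   Context: All graphs are finite and simple. For a sequence $v=(v_1,\dots,v_t)$ of positive integers, $K(v)$ is the complete $t$-partite graph with parts $V_1,\dots,V_t$, $|V_i|=v_i$. $\langle E\rangle$ is the subgraph of $K(v)$ consisting of the edges of $E$ and their endpoints. An $E$-subgraph is a subgraph $G_1$ of $K(v)$ which is a complete multipartite graph (with at least two nonempty parts) such that every part of $G_1$ is contained in some part of $K(v)$ and every edge of $G_1$ belongs to $E$. A garland is a nonempty set of pairwise vertex-disjoint $E$-subgraphs. A $\Xi_2$-subgraph is the subgraph formed by two edges $e_1,e_2\in E$ lying in a triangle of $K(v)$ whose third edge is not in $E$ (i.e. a triangle of $K(v)$ with exactly two edges in $E$). -}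

module Defs where

open import Data.Nat using (ℕ; _<ᵇ_)
open import Data.Fin using (Fin; toℕ)
open import Data.Fin.Properties using (_≟_)
open import Data.Bool using (Bool; true; false; _∨_; _∧_; if_then_else_)
open import Data.List using (List; length; map; allFin)
open import Data.Nat.ListAction using (sum)
open import Data.List.Relation.Unary.All using (All)
open import Data.List.Relation.Unary.AllPairs using (AllPairs)
open import Data.Product using (Σ; ∃; _×_; proj₁; proj₂)
open import Relation.Binary.PropositionalEquality using (_≡_; _≢_)
open import Relation.Nullary using (¬_)
open import Relation.Nullary.Decidable using (⌊_⌋)

-- Vertices of K(v) are Fin n; p : Fin n → Fin t assigns each vertex its part V_i.
-- With p surjective, K(v) has v_i = |p⁻¹(i)| > 0.

Rel₂ : ℕ → Set
Rel₂ n = Fin n → Fin n → Bool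

Surjective : {n t : ℕ} → (Fin n → Fin t) → Set
Surjective {n} {t} p = (i : Fin t) → ∃ λ (x : Fin n) → p x ≡ i

-- E is a set of edges of K(v): a symmetric relation relating only vertices
-- in different parts.  E x y ≡ true  means  {x,y} ∈ E.
IsEdgeSet : {n t : ℕ} → (Fin n → Fin t) → Rel₂ n → Set
IsEdgeSet {n} p E =
  ((x y : Fin n) → E x y ≡ E y x) ×
  ((x y : Fin n) → E x y ≡ true → p x ≢ p y)

-- Number of unordered pairs {x,y} (x < y) related by R: the cardinality of an edge set.
countPairs : (n : ℕ) → Rel₂ n → ℕ
countPairs n R =
  sum (map (λ x → sum (map (λ y → if (toℕ x <ᵇ toℕ y) ∧ R x y then 1 else 0)
                           (allFin n)))
           (allFin n))

samePair : {n : ℕ} → Fin n → Fin n → Fin n → Fin n → Bool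
samePair a b c d = (⌊ a ≟ c ⌋ ∧ ⌊ b ≟ d ⌋) ∨ (⌊ a ≟ d ⌋ ∧ ⌊ b ≟ c ⌋)

-- x,y,z form a triangle of K(v) with exactly two edges xy, yz in E (xz ∉ E).
IsXi2 : {n t : ℕ} → (Fin n → Fin t) → Rel₂ n → Fin n → Fin n → Fin n → Set
IsXi2 p E x y z =
  p x ≢ p y × p y ≢ p z × p x ≢ p z ×
  E x y ≡ true × E y z ≡ true × E x z ≡ false

xiEdges : {n : ℕ} → Fin n → Fin n → Fin n → Rel₂ n
xiEdges x y z a b = samePair a b x y ∨ samePair a b y z

-- A garland is encoded by two relations on vertices:
--   S x y : x and y are covered by the same E-subgraph of the garland
--   P x y : x and y lie in the same part of the same E-subgraph.
-- The E-subgraphs of the garland are the S-classes (pairwise vertex-disjoint),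
-- each being the complete multipartite graph whose parts are the P-classes inside it.
record IsGarland {n t : ℕ} (p : Fin n → Fin t) (E : Rel₂ n) (S P : Rel₂ n) : Set where
  field
    S-sym    : (x y : Fin n) → S x y ≡ S y x
    S-trans  : (x y z : Fin n) → S x y ≡ true → S y z ≡ true → S x z ≡ true
    P-sym    : (x y : Fin n) → P x y ≡ P y x
    P-trans  : (x y z : Fin n) → P x y ≡ true → P y z ≡ true → P x z ≡ true
    P⊆S      : (x y : Fin n) → P x y ≡ true → S x y ≡ true
    P-refl   : (x : Fin n) → S x x ≡ true → P x x ≡ true
    P-inPart : (x y : Fin n) → P x y ≡ true → p x ≡ p y
    edgesInE : (x y : Fin n) → S x y ≡ true → P x y ≡ false → E x y ≡ true
    twoParts : (x : Fin n) → S x x ≡ true → ∃ λ y → S x y ≡ true × P x y ≡ false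
    nonempty : ∃ λ x → S x x ≡ true

GarlandData : ℕ → Set
GarlandData n = Rel₂ n × Rel₂ n

_≈G_ : {n : ℕ} → GarlandData n → GarlandData n → Set
_≈G_ {n} G H = (x y : Fin n) → (proj₁ G x y ≡ proj₁ H x y) × (proj₂ G x y ≡ proj₂ H x y)

-- "the number of garlands does not exceed N": any list of pairwise distinct garlands
-- has length at most N.
GarlandsAtMost : {n t : ℕ} → (Fin n → Fin t) → Rel₂ n → ℕ → Set
GarlandsAtMost {n} p E N =
  (L : List (GarlandData n)) →
  All (λ G → IsGarland p E (proj₁ G) (proj₂ G)) L →
  AllPairs (λ G H → ¬ (G ≈G H)) L →
  length L Data.Nat.≤ N

module Submission where

-- Enumerate the m = |E| edges of E once each (as ordered pairs a < b) and
-- encode a garland by the 0/1-vector, indexed by these edges, of the edges of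
-- its E-subgraphs.  This code determines the garland (its subgraphs are the
-- connected pieces of its edge set, its parts the non-adjacent pairs inside a
-- piece), it is nonzero (a garland has an edge) and it never contains the edge
-- set {xy, yz} of a Ξ₂-subgraph (otherwise x, z lie in one E-subgraph, so xz
-- would be an edge of it, yet xz ∉ E and x, z lie in different parts of K(v)).
-- Hence, for masks M₁, M₂ coding two Ξ₂-subgraphs, the garlands inject into the
-- vectors v ∈ {0,1}ᵐ with v ≠ 0, v ⊉ M₁, v ⊉ M₂, and inclusion–exclusion counts
-- these as 2ᵐ − 1 − 2^(m−|M₁|) − 2^(m−|M₂|) + 2^(m−|M₁∪M₂|).  With |Mᵢ| ≤ 2
-- this gives both bounds (the second one does not even need E₁ ≠ E₂).

open import Defs
open import Data.Nat using (ℕ; zero; suc; _+_; _*_; _∸_; _^_; _≤_; _<_; _<ᵇ_; z≤n; s≤s)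
open import Data.Nat.Properties
  using ( +-identityʳ; +-suc; +-assoc; +-∸-assoc; +-cancelʳ-≡; +-cancelʳ-≤; +-mono-≤; +-monoʳ-≤
        ; +-monoˡ-≤; *-monoʳ-≤; ≤-refl; ≤-trans; ≤-reflexive; m≤n⇒m≤1+n; n≤1+n; m+n≤o⇒m≤o∸n
        ; ^-monoʳ-≤; ^-distribˡ-+-*; m≤n+m∸n; ∸-+-assoc; ∸-monoʳ-≤; <-cmp; <-asym; <⇒<ᵇ; <ᵇ⇒<
        ; +-commutativeSemigroup; module ≤-Reasoning)
open import Data.Fin using (Fin; toℕ)
open import Data.Fin.Properties using (toℕ-injective; _≟_)
open import Data.Bool using (Bool; true; false; _∧_; _∨_; not; if_then_else_)
open import Data.Bool.Properties
  using ( ∧-inverseˡ; ∨-inverseˡ; ∧-zeroʳ; ∧-identityʳ; ∧-distribˡ-∨; ∧-comm; ∨-comm; ∨-zeroʳ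
        ; ∨-idem; ¬-not; T-≡; T-∧; T-∨)
  renaming (_≟_ to _≟ᵇ_)
open import Data.Vec using (Vec; []; _∷_; zipWith; fromList)
import Data.Vec as Vec
open import Data.Vec.Properties using (zipWith-idem; ∷-injectiveˡ; ∷-injectiveʳ)
open import Data.List using (List; []; _∷_; length; _++_; map; filterᵇ; cartesianProduct; allFin)
open import Data.List.Properties using (length-map)
open import Data.Nat.ListAction using (sum)
open import Data.List.Relation.Unary.All using (All; []; _∷_)
import Data.List.Relation.Unary.All as All
import Data.List.Relation.Unary.All.Properties as All
open import Data.List.Relation.Unary.AllPairs using (AllPairs; []; _∷_)
open import Data.List.Relation.Unary.Any using (here; there)
open import Data.List.Relation.Unary.Unique.Propositional using (Unique)
open import Data.List.Relation.Unary.Unique.Propositional.Properties using (filter⁺; cartesianProduct⁺; allFin⁺)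
open import Data.List.Membership.Propositional using (_∈_)
open import Data.List.Membership.Propositional.Properties
  using (∈-filter⁺; ∈-filter⁻; ∈-cartesianProduct⁺; ∈-allFin)
open import Data.Product using (∃; _×_; _,_; proj₁; proj₂)
open import Data.Sum using (_⊎_; inj₁; inj₂)
open import Data.Empty using (⊥; ⊥-elim)
open import Function using (_∘_)
open import Function.Bundles using (Equivalence)
open import Relation.Nullary using (¬_; yes; no)
open import Relation.Nullary.Decidable using (T?; ⌊_⌋; toWitness; fromWitness)
open import Relation.Binary.Definitions using (tri<; tri≈; tri>)
open import Relation.Binary.PropositionalEquality
open import Algebra.Properties.CommutativeSemigroup +-commutativeSemigroup using (interchange)
open import Data.Nat.Tactic.RingSolver using (solve-∀)

ind : Bool → ℕ
ind b = if b then 1 else 0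

false≢true : false ≢ true
false≢true ()

true-equiv : ∀ {a b} → (a ≡ true → b ≡ true) → (b ≡ true → a ≡ true) → a ≡ b
true-equiv {false} {false} _ _   = refl
true-equiv {false} {true}  _ b⇒a = b⇒a refl
true-equiv {true}          a⇒b _ = sym (a⇒b refl)


count : (m : ℕ) → (Vec Bool m → Bool) → ℕ
count zero    Q = ind (Q [])
count (suc m) Q = count m (λ v → Q (true ∷ v)) + count m (λ v → Q (false ∷ v))

count-ext : ∀ m {Q Q′ : Vec Bool m → Bool} → (∀ v → Q v ≡ Q′ v) → count m Q ≡ count m Q′
count-ext zero    eq = cong ind (eq [])
count-ext (suc m) eq = cong₂ _+_ (count-ext m (λ v → eq _)) (count-ext m (λ v → eq _))

count-none : ∀ m → count m (λ _ → false) ≡ 0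
count-none zero    = refl
count-none (suc m) = cong₂ _+_ (count-none m) (count-none m)

count-all : ∀ m → count m (λ _ → true) ≡ 2 ^ m
count-all zero    = refl
count-all (suc m) = begin
  count m (λ _ → true) + count m (λ _ → true)  ≡⟨ cong₂ _+_ (count-all m) (count-all m) ⟩
  2 ^ m + 2 ^ m                                ≡⟨ cong (2 ^ m +_) (sym (+-identityʳ (2 ^ m))) ⟩
  2 ^ suc m                                    ∎
  where open ≡-Reasoning

count-∧∨ : ∀ m (Q Q′ : Vec Bool m → Bool) →
  count m Q + count m Q′ ≡ count m (λ v → Q v ∧ Q′ v) + count m (λ v → Q v ∨ Q′ v)
count-∧∨ zero Q Q′ = base (Q []) (Q′ [])
  where
  base : ∀ a b → ind a + ind b ≡ ind (a ∧ b) + ind (a ∨ b)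
  base false b     = refl
  base true  false = refl
  base true  true  = refl
count-∧∨ (suc m) Q Q′ = begin
  (q₁ + q₀) + (q₁′ + q₀′)  ≡⟨ interchange q₁ q₀ q₁′ q₀′ ⟩
  (q₁ + q₁′) + (q₀ + q₀′)  ≡⟨ cong₂ _+_ (count-∧∨ m _ _) (count-∧∨ m _ _) ⟩
  (a₁ + o₁) + (a₀ + o₀)    ≡⟨ interchange a₁ o₁ a₀ o₀ ⟩
  (a₁ + a₀) + (o₁ + o₀)    ∎
  where
  open ≡-Reasoning
  q₁  = count m (λ v → Q (true ∷ v))
  q₀  = count m (λ v → Q (false ∷ v))
  q₁′ = count m (λ v → Q′ (true ∷ v))
  q₀′ = count m (λ v → Q′ (false ∷ v))
  a₁  = count m (λ v → Q (true ∷ v) ∧ Q′ (true ∷ v))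
  a₀  = count m (λ v → Q (false ∷ v) ∧ Q′ (false ∷ v))
  o₁  = count m (λ v → Q (true ∷ v) ∨ Q′ (true ∷ v))
  o₀  = count m (λ v → Q (false ∷ v) ∨ Q′ (false ∷ v))

count-complement : ∀ m (Q : Vec Bool m → Bool) → count m (λ v → not (Q v)) + count m Q ≡ 2 ^ m
count-complement m Q = begin
  count m (λ v → not (Q v)) + count m Q
    ≡⟨ count-∧∨ m (λ v → not (Q v)) Q ⟩
  count m (λ v → not (Q v) ∧ Q v) + count m (λ v → not (Q v) ∨ Q v)
    ≡⟨ cong₂ _+_ (count-ext m (λ v → ∧-inverseˡ (Q v))) (count-ext m (λ v → ∨-inverseˡ (Q v))) ⟩
  count m (λ _ → false) + count m (λ _ → true)
    ≡⟨ cong₂ _+_ (count-none m) (count-all m) ⟩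
  2 ^ m ∎
  where open ≡-Reasoning

withHead : ∀ {m} → Bool → List (Vec Bool (suc m)) → List (Vec Bool m)
withHead b [] = []
withHead b ((c ∷ v) ∷ L) with c ≟ᵇ b
... | yes _ = v ∷ withHead b L
... | no  _ = withHead b L

length-withHead : ∀ {m} (L : List (Vec Bool (suc m))) →
  length L ≡ length (withHead true L) + length (withHead false L)
length-withHead [] = refl
length-withHead ((true  ∷ v) ∷ L) = cong suc (length-withHead L)
length-withHead ((false ∷ v) ∷ L) = trans (cong suc (length-withHead L)) (sym (+-suc _ _))

All-withHead : ∀ {m} {P : Vec Bool (suc m) → Set} b {L} →
  All P L → All (λ v → P (b ∷ v)) (withHead b L)
All-withHead b [] = []
All-withHead b {(c ∷ v) ∷ L} (px ∷ pxs) with c ≟ᵇ b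
... | yes refl = px ∷ All-withHead b pxs
... | no  _    = All-withHead b pxs

distinct-withHead : ∀ {m} b {L : List (Vec Bool (suc m))} →
  AllPairs _≢_ L → AllPairs _≢_ (withHead b L)
distinct-withHead b [] = []
distinct-withHead b {(c ∷ v) ∷ L} (px ∷ pxs) with c ≟ᵇ b
... | yes refl = All.map (λ ne eq → ne (cong (c ∷_) eq)) (All-withHead b px) ∷ distinct-withHead b pxs
... | no  _    = distinct-withHead b pxs

pigeonhole : ∀ m (Q : Vec Bool m → Bool) (L : List (Vec Bool m)) →
  All (λ v → Q v ≡ true) L → AllPairs _≢_ L → length L ≤ count m Q
pigeonhole zero Q [] _ _ = z≤n
pigeonhole zero Q ([] ∷ []) (q ∷ _) _ rewrite q = ≤-refl
pigeonhole zero Q ([] ∷ [] ∷ _) _ ((ne ∷ _) ∷ _) = ⊥-elim (ne refl)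
pigeonhole (suc m) Q L sat distinct = begin
  length L                                              ≡⟨ length-withHead L ⟩
  length (withHead true L) + length (withHead false L)  ≤⟨ +-mono-≤ (byHead true) (byHead false) ⟩
  count (suc m) Q                                       ∎
  where
  open ≤-Reasoning
  byHead : ∀ b → length (withHead b L) ≤ count m (λ v → Q (b ∷ v))
  byHead b = pigeonhole m _ (withHead b L) (All-withHead b sat) (distinct-withHead b distinct)

-- A vector M ∈ {0,1}ᵐ is read as a mask (a subset of the positions):
-- covers M v  says that v has a 1 wherever M has one, weight M is |M|.
covers : ∀ {m} → Vec Bool m → Vec Bool m → Bool
covers []      []      = true
covers (a ∷ M) (b ∷ v) = (not a ∨ b) ∧ covers M v

isZero : ∀ {m} → Vec Bool m → Bool
isZero []      = true
isZero (b ∷ v) = not b ∧ isZero v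

weight : ∀ {m} → Vec Bool m → ℕ
weight []      = 0
weight (b ∷ M) = ind b + weight M

weight≤length : ∀ {m} (M : Vec Bool m) → weight M ≤ m
weight≤length []          = z≤n
weight≤length (true ∷ M)  = s≤s (weight≤length M)
weight≤length (false ∷ M) = m≤n⇒m≤1+n (weight≤length M)

-- The vectors containing a mask M are free on the m − |M| other positions.
count-covers : ∀ m (M : Vec Bool m) → count m (covers M) ≡ 2 ^ (m ∸ weight M)
count-covers zero    []          = refl
count-covers (suc m) (true ∷ M)  = begin
  count m (covers M) + count m (λ _ → false)  ≡⟨ cong₂ _+_ (count-covers m M) (count-none m) ⟩
  2 ^ (m ∸ weight M) + 0                       ≡⟨ +-identityʳ _ ⟩
  2 ^ (m ∸ weight M)                           ∎
  where open ≡-Reasoning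
count-covers (suc m) (false ∷ M) = begin
  count m (covers M) + count m (covers M)      ≡⟨ cong₂ _+_ (count-covers m M) (count-covers m M) ⟩
  2 ^ (m ∸ weight M) + 2 ^ (m ∸ weight M)      ≡⟨ cong (2 ^ (m ∸ weight M) +_) (sym (+-identityʳ _)) ⟩
  2 ^ suc (m ∸ weight M)                       ≡⟨ cong (2 ^_) (sym (+-∸-assoc 1 (weight≤length M))) ⟩
  2 ^ (suc m ∸ weight M)                       ∎
  where open ≡-Reasoning

count-isZero : ∀ m → count m isZero ≡ 1
count-isZero zero    = refl
count-isZero (suc m) = cong₂ _+_ (count-none m) (count-isZero m)

covers-∨ : ∀ {m} (M₁ M₂ v : Vec Bool m) → covers (zipWith _∨_ M₁ M₂) v ≡ covers M₁ v ∧ covers M₂ v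
covers-∨ []       []       []      = refl
covers-∨ (a ∷ M₁) (c ∷ M₂) (b ∷ v) =
  trans (cong ((not (a ∨ c) ∨ b) ∧_) (covers-∨ M₁ M₂ v)) (guard-split a c b _ _)
  where
  guard-split : ∀ a c b x y → (not (a ∨ c) ∨ b) ∧ (x ∧ y) ≡ ((not a ∨ b) ∧ x) ∧ ((not c ∨ b) ∧ y)
  guard-split false false b     x y = refl
  guard-split false true  false x y = sym (∧-zeroʳ x)
  guard-split false true  true  x y = refl
  guard-split true  c     false x y = refl
  guard-split true  false true  x y = refl
  guard-split true  true  true  x y = refl

zero-covers : ∀ {m} (M v : Vec Bool m) → isZero M ≡ false → isZero v ∧ covers M v ≡ false
zero-covers (a ∷ M)     (true ∷ v)  nz = refl
zero-covers (true ∷ M)  (false ∷ v) nz = ∧-zeroʳ (isZero v)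
zero-covers (false ∷ M) (false ∷ v) nz = zero-covers M v nz

Avoids : ∀ {m} → Vec Bool m → Vec Bool m → Vec Bool m → Bool
Avoids M₁ M₂ v = not (isZero v ∨ (covers M₁ v ∨ covers M₂ v))

-- Inclusion–exclusion: #Avoids = 2ᵐ − 1 − 2^(m−|M₁|) − 2^(m−|M₂|) + 2^(m−|M₁∪M₂|),
-- stated additively to stay within ℕ.
count-Avoids : ∀ m (M₁ M₂ : Vec Bool m) → isZero M₁ ≡ false → isZero M₂ ≡ false →
  count m (Avoids M₁ M₂) + 1 + (2 ^ (m ∸ weight M₁) + 2 ^ (m ∸ weight M₂))
    ≡ 2 ^ m + 2 ^ (m ∸ weight (zipWith _∨_ M₁ M₂))
count-Avoids m M₁ M₂ nz₁ nz₂ = begin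
  #A + 1 + (2 ^ (m ∸ weight M₁) + 2 ^ (m ∸ weight M₂))
    ≡⟨ cong₂ (λ z c → #A + z + c) (sym (count-isZero m))
             (sym (cong₂ _+_ (count-covers m M₁) (count-covers m M₂))) ⟩
  #A + #Z + (count m C₁ + count m C₂)
    ≡⟨ cong (#A + #Z +_) (count-∧∨ m C₁ C₂) ⟩
  #A + #Z + (#C₁₂ + #B)
    ≡⟨ regroup #A #Z #C₁₂ #B ⟩
  #A + (#Z + #B) + #C₁₂
    ≡⟨ cong (λ z → #A + z + #C₁₂) zero-apart ⟩
  #A + count m (λ v → isZero v ∨ B v) + #C₁₂
    ≡⟨ cong (_+ #C₁₂) (count-complement m (λ v → isZero v ∨ B v)) ⟩
  2 ^ m + #C₁₂
    ≡⟨ cong (2 ^ m +_) (trans (count-ext m (λ v → sym (covers-∨ M₁ M₂ v)))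
                              (count-covers m (zipWith _∨_ M₁ M₂))) ⟩
  2 ^ m + 2 ^ (m ∸ weight (zipWith _∨_ M₁ M₂)) ∎
  where
  open ≡-Reasoning
  C₁ C₂ B : Vec Bool m → Bool
  C₁ = covers M₁
  C₂ = covers M₂
  B v = C₁ v ∨ C₂ v
  #A = count m (Avoids M₁ M₂)
  #Z = count m isZero
  #B = count m B
  #C₁₂ = count m (λ v → C₁ v ∧ C₂ v)
  regroup : ∀ a z c b → a + z + (c + b) ≡ a + (z + b) + c
  regroup = solve-∀
  -- the zero vector lies outside B, so it and B are counted disjointly
  zero-apart : #Z + #B ≡ count m (λ v → isZero v ∨ B v)
  zero-apart = begin
    #Z + #B  ≡⟨ count-∧∨ m isZero B ⟩
    count m (λ v → isZero v ∧ B v) + count m (λ v → isZero v ∨ B v)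
      ≡⟨ cong (_+ count m (λ v → isZero v ∨ B v)) (trans (count-ext m disjoint) (count-none m)) ⟩
    count m (λ v → isZero v ∨ B v) ∎
    where
    disjoint : ∀ v → isZero v ∧ B v ≡ false
    disjoint v = trans (∧-distribˡ-∨ (isZero v) (C₁ v) (C₂ v))
                       (cong₂ _∨_ (zero-covers M₁ v nz₁) (zero-covers M₂ v nz₂))

count-Avoids-one : ∀ m (M : Vec Bool m) → isZero M ≡ false →
  count m (Avoids M M) + 1 + 2 ^ (m ∸ weight M) ≡ 2 ^ m
count-Avoids-one m M nz = +-cancelʳ-≡ Y _ _ (begin
  count m (Avoids M M) + 1 + Y + Y    ≡⟨ +-assoc (count m (Avoids M M) + 1) Y Y ⟩
  count m (Avoids M M) + 1 + (Y + Y)  ≡⟨ count-Avoids m M M nz nz ⟩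
  2 ^ m + 2 ^ (m ∸ weight (zipWith _∨_ M M))
    ≡⟨ cong (λ N → 2 ^ m + 2 ^ (m ∸ weight N)) (zipWith-idem ∨-idem M) ⟩
  2 ^ m + Y                           ∎)
  where
  open ≡-Reasoning
  Y = 2 ^ (m ∸ weight M)

pow-halve : ∀ n → 2 ^ n ≤ 2 * 2 ^ (n ∸ 1)
pow-halve n = ≤-trans (^-monoʳ-≤ 2 (m≤n+m∸n n 1)) (≤-reflexive (^-distribˡ-+-* 2 1 (n ∸ 1)))

pow-halve′ : ∀ n → 2 ^ (n ∸ 1) ≤ 2 * 2 ^ (n ∸ 2)
pow-halve′ n = subst (λ k → 2 ^ (n ∸ 1) ≤ 2 * 2 ^ k) (∸-+-assoc n 1 1) (pow-halve (n ∸ 1))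

pow-∸-anti : ∀ m {k} → k ≤ 2 → 2 ^ (m ∸ 2) ≤ 2 ^ (m ∸ k)
pow-∸-anti m k≤2 = ^-monoʳ-≤ 2 (∸-monoʳ-≤ m k≤2)

bound-one : ∀ m k q → k ≤ 2 → q + 1 + 2 ^ (m ∸ k) ≡ 2 ^ m → q ≤ 3 * 2 ^ (m ∸ 2) ∸ 1
bound-one m k q k≤2 eq = m+n≤o⇒m≤o∸n q (+-cancelʳ-≤ X (q + 1) (3 * X) (begin
  q + 1 + X              ≤⟨ +-monoʳ-≤ (q + 1) (pow-∸-anti m k≤2) ⟩
  q + 1 + 2 ^ (m ∸ k)    ≡⟨ eq ⟩
  2 ^ m                  ≤⟨ pow-halve m ⟩
  2 * 2 ^ (m ∸ 1)        ≤⟨ *-monoʳ-≤ 2 (pow-halve′ m) ⟩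
  2 * (2 * X)            ≡⟨ four X ⟩
  3 * X + X              ∎))
  where
  open ≤-Reasoning
  X = 2 ^ (m ∸ 2)
  four : ∀ X → 2 * (2 * X) ≡ 3 * X + X
  four = solve-∀

bound-two : ∀ m k₁ k₂ q Z → k₁ ≤ 2 → k₂ ≤ 2 →
  q + 1 + (2 ^ (m ∸ k₁) + 2 ^ (m ∸ k₂)) ≡ 2 ^ m + Z → q ≤ 2 ^ (m ∸ 1) + Z ∸ 1
bound-two m k₁ k₂ q Z k₁≤2 k₂≤2 eq = m+n≤o⇒m≤o∸n q (+-cancelʳ-≤ (X + X) (q + 1) (Y + Z) (begin
  q + 1 + (X + X)
    ≤⟨ +-monoʳ-≤ (q + 1) (+-mono-≤ (pow-∸-anti m k₁≤2) (pow-∸-anti m k₂≤2)) ⟩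
  q + 1 + (2 ^ (m ∸ k₁) + 2 ^ (m ∸ k₂))  ≡⟨ eq ⟩
  2 ^ m + Z                              ≤⟨ +-monoˡ-≤ Z (pow-halve m) ⟩
  2 * Y + Z                              ≡⟨ split Y Z ⟩
  Y + Y + Z                              ≤⟨ +-monoˡ-≤ Z (+-monoʳ-≤ Y (pow-halve′ m)) ⟩
  Y + 2 * X + Z                          ≡⟨ regroup Y X Z ⟩
  Y + Z + (X + X)                        ∎))
  where
  open ≤-Reasoning
  X = 2 ^ (m ∸ 2)
  Y = 2 ^ (m ∸ 1)
  split : ∀ Y Z → 2 * Y + Z ≡ Y + Y + Z
  split = solve-∀
  regroup : ∀ Y X Z → Y + 2 * X + Z ≡ Y + Z + (X + X)
  regroup = solve-∀

module _ {A : Set} where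

  tally : (A → Bool) → List A → ℕ
  tally f []       = 0
  tally f (x ∷ xs) = ind (f x) + tally f xs

  tally-ext : ∀ {f g : A → Bool} xs → (∀ x → f x ≡ g x) → tally f xs ≡ tally g xs
  tally-ext []       eq = refl
  tally-ext (x ∷ xs) eq = cong₂ _+_ (cong ind (eq x)) (tally-ext xs eq)

  tally-++ : ∀ (f : A → Bool) xs ys → tally f (xs ++ ys) ≡ tally f xs + tally f ys
  tally-++ f []       ys = refl
  tally-++ f (x ∷ xs) ys = trans (cong (ind (f x) +_) (tally-++ f xs ys)) (sym (+-assoc (ind (f x)) _ _))

  length-filterᵇ : ∀ (g : A → Bool) xs → length (filterᵇ g xs) ≡ tally g xs
  length-filterᵇ g []       = refl
  length-filterᵇ g (x ∷ xs) with g x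
  ... | true  = cong suc (length-filterᵇ g xs)
  ... | false = length-filterᵇ g xs

  tally-filterᵇ : ∀ (f g : A → Bool) xs → tally f (filterᵇ g xs) ≡ tally (λ x → g x ∧ f x) xs
  tally-filterᵇ f g []       = refl
  tally-filterᵇ f g (x ∷ xs) with g x
  ... | true  = cong (ind (f x) +_) (tally-filterᵇ f g xs)
  ... | false = tally-filterᵇ f g xs

  tally-∨ : ∀ (f g : A → Bool) xs → tally (λ x → f x ∨ g x) xs ≤ tally f xs + tally g xs
  tally-∨ f g []       = z≤n
  tally-∨ f g (x ∷ xs) with f x | g x
  ... | true  | true  = s≤s (≤-trans (tally-∨ f g xs) (+-monoʳ-≤ (tally f xs) (n≤1+n _)))
  ... | true  | false = s≤s (tally-∨ f g xs)
  ... | false | true  = ≤-trans (s≤s (tally-∨ f g xs)) (≤-reflexive (sym (+-suc _ _)))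
  ... | false | false = tally-∨ f g xs

  tally-none : ∀ (f : A → Bool) xs → All (λ x → f x ≡ false) xs → tally f xs ≡ 0
  tally-none f []       []         = refl
  tally-none f (x ∷ xs) (fx ∷ fxs) rewrite fx = tally-none f xs fxs

  tally-unique : ∀ (f : A → Bool) xs → Unique xs →
    (∀ {x y} → x ∈ xs → y ∈ xs → f x ≡ true → f y ≡ true → x ≡ y) → tally f xs ≤ 1
  tally-unique f []       _          _   = z≤n
  tally-unique f (x ∷ xs) (x∉ ∷ uniq) one with f x in fx
  ... | false = tally-unique f xs uniq (λ p q → one (there p) (there q))
  ... | true  = ≤-reflexive (cong suc (tally-none f xs (All.tabulate others)))
    where
    others : ∀ {y} → y ∈ xs → f y ≡ false
    others {y} y∈ = ¬-not (λ fy → All.lookup x∉ y∈ (one (here refl) (there y∈) fx fy))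

  weight-map : ∀ (f : A → Bool) xs → weight (Vec.map f (fromList xs)) ≡ tally f xs
  weight-map f []       = refl
  weight-map f (x ∷ xs) = cong (ind (f x) +_) (weight-map f xs)

  map-agree : ∀ (f g : A → Bool) xs → Vec.map f (fromList xs) ≡ Vec.map g (fromList xs) →
    ∀ {x} → x ∈ xs → f x ≡ g x
  map-agree f g (x ∷ xs) eq (here refl) = ∷-injectiveˡ eq
  map-agree f g (x ∷ xs) eq (there x∈) = map-agree f g xs (∷-injectiveʳ eq) x∈

  map-nonzero : ∀ (f : A → Bool) xs {x} → x ∈ xs → f x ≡ true → isZero (Vec.map f (fromList xs)) ≡ false
  map-nonzero f (x ∷ xs) (here refl) fx rewrite fx = refl
  map-nonzero f (y ∷ xs) (there x∈) fx rewrite map-nonzero f xs x∈ fx = ∧-zeroʳ (not (f y))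

  map-covers : ∀ (f g : A → Bool) xs → covers (Vec.map f (fromList xs)) (Vec.map g (fromList xs)) ≡ true →
    ∀ {x} → x ∈ xs → f x ≡ true → g x ≡ true
  map-covers f g (x ∷ xs) cov (here refl) fx with f x | g x
  ... | true  | true  = refl
  ... | true  | false = ⊥-elim (false≢true cov)
  map-covers f g (y ∷ xs) cov (there x∈) fx with f y | g y
  ... | false | _    = map-covers f g xs cov x∈ fx
  ... | true  | true = map-covers f g xs cov x∈ fx

  zipWith-∨-map : ∀ {k} (f g : A → Bool) (v : Vec A k) →
    zipWith _∨_ (Vec.map f v) (Vec.map g v) ≡ Vec.map (λ x → f x ∨ g x) v
  zipWith-∨-map f g []      = refl
  zipWith-∨-map f g (x ∷ v) = cong ((f x ∨ g x) ∷_) (zipWith-∨-map f g v)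

tally-cartesian : ∀ {A B : Set} (h : A × B → Bool) (xs : List A) (ys : List B) →
  sum (map (λ x → sum (map (λ y → ind (h (x , y))) ys)) xs) ≡ tally h (cartesianProduct xs ys)
tally-cartesian h []       ys = refl
tally-cartesian h (x ∷ xs) ys =
  trans (cong₂ _+_ (row ys) (tally-cartesian h xs ys)) (sym (tally-++ h (map (x ,_) ys) _))
  where
  row : ∀ ys → sum (map (λ y → ind (h (x , y))) ys) ≡ tally h (map (x ,_) ys)
  row []       = refl
  row (y ∷ ys) = cong (ind (h (x , y)) +_) (row ys)

map-distinct : ∀ {A B : Set} {P : A → Set} {_≈_ : A → A → Set} (f : A → B) →
  (∀ {x y} → P x → P y → f x ≡ f y → x ≈ y) →
  ∀ {L} → All P L → AllPairs (λ x y → ¬ (x ≈ y)) L → AllPairs _≢_ (map f L)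
map-distinct f inj []         []       = []
map-distinct f inj (px ∷ pxs) (r ∷ rs) =
  All.map⁺ (All.zipWith (λ (py , x≉y) fx≡fy → x≉y (inj px py fx≡fy)) (pxs , r)) ∷ map-distinct f inj pxs rs

_⊆ᴿ_ : {n : ℕ} → Rel₂ n → Rel₂ n → Set
_⊆ᴿ_ {n} R R′ = (a b : Fin n) → R a b ≡ true → R′ a b ≡ true

∨-⊆ᴿ : {n : ℕ} {R R′ T : Rel₂ n} → R ⊆ᴿ T → R′ ⊆ᴿ T → (λ a b → R a b ∨ R′ a b) ⊆ᴿ T
∨-⊆ᴿ {R = R} R⊆T R′⊆T a b e with R a b in r
... | true  = R⊆T a b r
... | false = R′⊆T a b e

Symmetric : {n : ℕ} → Rel₂ n → Set
Symmetric {n} R = (a b : Fin n) → R a b ≡ R b a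

edgeOf : {n : ℕ} → Fin n → Fin n → Rel₂ n
edgeOf u w a b = samePair a b u w

module _ {n : ℕ} where

  samePair-sound : (a b c d : Fin n) → samePair a b c d ≡ true → (a ≡ c × b ≡ d) ⊎ (a ≡ d × b ≡ c)
  samePair-sound a b c d eq with Equivalence.to T-∨ (Equivalence.from T-≡ eq)
  ... | inj₁ t = let (t₁ , t₂) = Equivalence.to T-∧ t
                 in inj₁ (toWitness {a? = a ≟ c} t₁ , toWitness {a? = b ≟ d} t₂)
  ... | inj₂ t = let (t₁ , t₂) = Equivalence.to T-∧ t
                 in inj₂ (toWitness {a? = a ≟ d} t₁ , toWitness {a? = b ≟ c} t₂)

  samePair-refl : (a b : Fin n) → samePair a b a b ≡ true
  samePair-refl a b = Equivalence.to T-≡ (Equivalence.from T-∨ (inj₁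
    (Equivalence.from T-∧ (fromWitness {a? = a ≟ a} refl , fromWitness {a? = b ≟ b} refl))))

  samePair-sym : (a b c d : Fin n) → samePair a b c d ≡ samePair b a c d
  samePair-sym a b c d =
    trans (∨-comm (⌊ a ≟ c ⌋ ∧ ⌊ b ≟ d ⌋) _) (cong₂ _∨_ (∧-comm ⌊ a ≟ d ⌋ _) (∧-comm ⌊ a ≟ c ⌋ _))

  samePair-transfer : (R : Rel₂ n) → Symmetric R → {a b u w : Fin n} →
    samePair a b u w ≡ true → R a b ≡ R u w
  samePair-transfer R sym-R {a} {b} {u} {w} s with samePair-sound a b u w s
  ... | inj₁ (refl , refl) = refl
  ... | inj₂ (refl , refl) = sym-R a b

  xiEdges-sym : (x y z : Fin n) → Symmetric (xiEdges x y z)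
  xiEdges-sym x y z a b = cong₂ _∨_ (samePair-sym a b x y) (samePair-sym a b y z)

module EdgeCode {n t : ℕ} (p : Fin n → Fin t) (E : Rel₂ n) (isE : IsEdgeSet p E) where

  Pair : Set
  Pair = Fin n × Fin n

  at : Rel₂ n → Pair → Bool
  at R (a , b) = R a b

  ordered : Pair → Bool
  ordered (a , b) = toℕ a <ᵇ toℕ b

  allPairs : List Pair
  allPairs = cartesianProduct (allFin n) (allFin n)

  edges : List Pair
  edges = filterᵇ (λ c → ordered c ∧ at E c) allPairs

  encode : Rel₂ n → Vec Bool (length edges)
  encode R = Vec.map (at R) (fromList edges)

  countPairs-tally : (R : Rel₂ n) → countPairs n R ≡ tally (λ c → ordered c ∧ at R c) allPairs
  countPairs-tally R = tally-cartesian (λ c → ordered c ∧ at R c) (allFin n) (allFin n)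

  length-edges : length edges ≡ countPairs n E
  length-edges = trans (length-filterᵇ _ allPairs) (sym (countPairs-tally E))

  weight-encode : (R : Rel₂ n) → R ⊆ᴿ E → weight (encode R) ≡ countPairs n R
  weight-encode R R⊆E = begin
    weight (encode R)                                     ≡⟨ weight-map (at R) edges ⟩
    tally (at R) edges                                    ≡⟨ tally-filterᵇ (at R) _ allPairs ⟩
    tally (λ c → (ordered c ∧ at E c) ∧ at R c) allPairs  ≡⟨ tally-ext allPairs absorb ⟩
    tally (λ c → ordered c ∧ at R c) allPairs             ≡⟨ sym (countPairs-tally R) ⟩
    countPairs n R                                        ∎
    where
    open ≡-Reasoning
    absorb′ : ∀ l e r → (r ≡ true → e ≡ true) → (l ∧ e) ∧ r ≡ l ∧ r
    absorb′ false e r     _ = refl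
    absorb′ true  e false _ = ∧-zeroʳ e
    absorb′ true  e true  h = trans (∧-identityʳ e) (h refl)
    absorb : ∀ c → (ordered c ∧ at E c) ∧ at R c ≡ ordered c ∧ at R c
    absorb (a , b) = absorb′ (ordered (a , b)) (E a b) (R a b) (R⊆E a b)

  edges-unique : Unique edges
  edges-unique = filter⁺ _ (cartesianProduct⁺ (allFin⁺ n) (allFin⁺ n))

  edges-ordered : ∀ {a b} → (a , b) ∈ edges → toℕ a < toℕ b
  edges-ordered {a} {b} c∈ =
    <ᵇ⇒< (toℕ a) (toℕ b) (proj₁ (Equivalence.to T-∧ (proj₂ (∈-filter⁻ (T? ∘ _) {xs = allPairs} c∈))))

  edges-complete : ∀ {a b} → toℕ a < toℕ b → E a b ≡ true → (a , b) ∈ edges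
  edges-complete {a} {b} a<b eab =
    ∈-filter⁺ (T? ∘ _) (∈-cartesianProduct⁺ (∈-allFin a) (∈-allFin b))
              (Equivalence.from T-∧ (<⇒<ᵇ a<b , Equivalence.from T-≡ eab))

  -- Every edge {a,b} of E is listed in one of its orientations (E has no loops,
  -- as its endpoints lie in different parts); a symmetric relation takes the
  -- same value on the listed pair as on (a , b).
  listed : ∀ {a b} → E a b ≡ true →
    ∃ λ c → c ∈ edges × ((R : Rel₂ n) → Symmetric R → at R c ≡ R a b)
  listed {a} {b} eab with <-cmp (toℕ a) (toℕ b)
  ... | tri< a<b _ _ = (a , b) , edges-complete a<b eab , λ R _ → refl
  ... | tri≈ _ a≡b _ = ⊥-elim (proj₂ isE a b eab (cong p (toℕ-injective a≡b)))
  ... | tri> _ _ b<a = (b , a) , edges-complete b<a (trans (proj₁ isE b a) eab) , λ R sym-R → sym-R b a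

  encode-nonzero : ∀ {R a b} → Symmetric R → E a b ≡ true → R a b ≡ true → isZero (encode R) ≡ false
  encode-nonzero {R} sym-R eab rab with listed eab
  ... | c , c∈ , same = map-nonzero (at R) edges c∈ (trans (same R sym-R) rab)

  encode-reflects : ∀ {R R′} → Symmetric R → Symmetric R′ → R ⊆ᴿ E → encode R ≡ encode R′ → R ⊆ᴿ R′
  encode-reflects {R} {R′} sym-R sym-R′ R⊆E eq a b rab with listed (R⊆E a b rab)
  ... | c , c∈ , same = begin
    R′ a b   ≡⟨ sym (same R′ sym-R′) ⟩
    at R′ c  ≡⟨ sym (map-agree (at R) (at R′) edges eq c∈) ⟩
    at R c   ≡⟨ same R sym-R ⟩
    R a b    ≡⟨ rab ⟩
    true     ∎
    where open ≡-Reasoning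

  encode-covers : ∀ {M R a b} → Symmetric M → Symmetric R → covers (encode M) (encode R) ≡ true →
    E a b ≡ true → M a b ≡ true → R a b ≡ true
  encode-covers {M} {R} sym-M sym-R cov eab mab with listed eab
  ... | c , c∈ , same =
    trans (sym (same R sym-R)) (map-covers (at M) (at R) edges cov c∈ (trans (same M sym-M) mab))

  edgeOf-once : (u w : Fin n) → tally (at (edgeOf u w)) edges ≤ 1
  edgeOf-once u w = tally-unique _ edges edges-unique one
    where
    one : ∀ {c c′} → c ∈ edges → c′ ∈ edges →
          at (edgeOf u w) c ≡ true → at (edgeOf u w) c′ ≡ true → c ≡ c′
    one {a , b} {a′ , b′} c∈ c′∈ s s′ with samePair-sound a b u w s | samePair-sound a′ b′ u w s′
    ... | inj₁ (refl , refl) | inj₁ (refl , refl) = refl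
    ... | inj₂ (refl , refl) | inj₂ (refl , refl) = refl
    ... | inj₁ (refl , refl) | inj₂ (refl , refl) = ⊥-elim (<-asym (edges-ordered c∈) (edges-ordered c′∈))
    ... | inj₂ (refl , refl) | inj₁ (refl , refl) = ⊥-elim (<-asym (edges-ordered c∈) (edges-ordered c′∈))

  weight-xiEdges : (x y z : Fin n) → weight (encode (xiEdges x y z)) ≤ 2
  weight-xiEdges x y z = begin
    weight (encode (xiEdges x y z))   ≡⟨ weight-map (at (xiEdges x y z)) edges ⟩
    tally (at (xiEdges x y z)) edges  ≤⟨ tally-∨ (at (edgeOf x y)) (at (edgeOf y z)) edges ⟩
    tally (at (edgeOf x y)) edges + tally (at (edgeOf y z)) edges
                                      ≤⟨ +-mono-≤ (edgeOf-once x y) (edgeOf-once y z) ⟩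
    2                                 ∎
    where open ≤-Reasoning

edgeRel : {n : ℕ} → Rel₂ n → Rel₂ n → Rel₂ n
edgeRel S P a b = S a b ∧ not (P a b)

module Garlands {n t : ℕ} (p : Fin n → Fin t) (E : Rel₂ n) (isE : IsEdgeSet p E) where
  open EdgeCode p E isE

  module Xi2 {x y z : Fin n} (ξ : IsXi2 p E x y z) where

    exy : E x y ≡ true
    exy = proj₁ (proj₂ (proj₂ (proj₂ ξ)))

    eyz : E y z ≡ true
    eyz = proj₁ (proj₂ (proj₂ (proj₂ (proj₂ ξ))))

    xi⊆E : xiEdges x y z ⊆ᴿ E
    xi⊆E a b e with samePair a b x y in s
    ... | true  = trans (samePair-transfer E (proj₁ isE) s) exy
    ... | false = trans (samePair-transfer E (proj₁ isE) e) eyz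

    xi-xy : xiEdges x y z x y ≡ true
    xi-xy = cong (_∨ samePair x y y z) (samePair-refl x y)

    xi-yz : xiEdges x y z y z ≡ true
    xi-yz = trans (cong (samePair y z x y ∨_) (samePair-refl y z)) (∨-zeroʳ _)

    xi-nonzero : isZero (encode (xiEdges x y z)) ≡ false
    xi-nonzero = encode-nonzero (xiEdges-sym x y z) exy xi-xy

  module Garland {S P : Rel₂ n} (g : IsGarland p E S P) where
    open IsGarland g

    R : Rel₂ n
    R = edgeRel S P

    R-sym : Symmetric R
    R-sym a b rewrite S-sym a b | P-sym a b = refl

    R-intro : ∀ {a b} → S a b ≡ true → P a b ≡ false → R a b ≡ true
    R-intro s q rewrite s | q = refl

    R-elim : ∀ {a b} → R a b ≡ true → S a b ≡ true × P a b ≡ false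
    R-elim {a} {b} r with S a b | P a b
    ... | true | false = refl , refl

    R⊆E : R ⊆ᴿ E
    R⊆E a b r = let (s , q) = R-elim r in edgesInE a b s q

    S-refl : ∀ {a b} → S a b ≡ true → S a a ≡ true
    S-refl {a} {b} s = S-trans a b a s (trans (S-sym b a) s)

    P-apart : ∀ {a b w} → P a b ≡ true → P a w ≡ false → P w b ≡ false
    P-apart {a} {b} {w} pab paw =
      ¬-not (λ pwb → false≢true (trans (sym paw) (P-trans a b w pab (trans (P-sym b w) pwb))))

    -- Two vertices of one E-subgraph are adjacent or have a common neighbour
    -- (any vertex of another part of that subgraph).
    S-path : ∀ {a b} → S a b ≡ true → R a b ≡ true ⊎ ∃ λ w → R a w ≡ true × R w b ≡ true
    S-path {a} {b} s = by-part (P a b) refl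
      where
      by-part : ∀ v → P a b ≡ v → R a b ≡ true ⊎ ∃ λ w → R a w ≡ true × R w b ≡ true
      by-part false q = inj₁ (R-intro s q)
      by-part true  q =
        let (w , saw , paw) = twoParts a (S-refl s)
        in inj₂ (w , R-intro saw paw , R-intro (S-trans w a b (trans (S-sym w a) saw) s) (P-apart q paw))

    -- A garland has an edge: it is nonempty and each E-subgraph has two parts.
    has-edge : ∃ λ a → ∃ λ b → R a b ≡ true
    has-edge = let (a , saa) = nonempty
                   (b , sab , pab) = twoParts a saa
               in a , b , R-intro sab pab

    -- A garland never contains both edges of a Ξ₂-subgraph xy, yz: then x, z
    -- would lie in one E-subgraph, in a common part (impossible, p x ≢ p z) or
    -- adjacent in it (impossible, xz ∉ E).
    no-Xi2 : ∀ {x y z} → IsXi2 p E x y z → R x y ≡ true → R y z ≡ true → ⊥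
    no-Xi2 {x} {y} {z} (_ , _ , pxz , _ , _ , exz) rxy ryz with P x z in q
    ... | true  = pxz (P-inPart x z q)
    ... | false = false≢true (trans (sym exz) (edgesInE x z sxz q))
      where
      sxz = S-trans x y z (proj₁ (R-elim rxy)) (proj₁ (R-elim ryz))

  module _ {S P S′ P′ : Rel₂ n} (g : IsGarland p E S P) (h : IsGarland p E S′ P′) where
    private
      module G = Garland g
      module H = Garland h

    S-from-edges : G.R ⊆ᴿ H.R → S ⊆ᴿ S′
    S-from-edges R⊆R′ a b s with G.S-path s
    ... | inj₁ r = proj₁ (H.R-elim (R⊆R′ a b r))
    ... | inj₂ (w , r₁ , r₂) =
      IsGarland.S-trans h a w b (proj₁ (H.R-elim (R⊆R′ a w r₁))) (proj₁ (H.R-elim (R⊆R′ w b r₂)))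

    P-from-edges : G.R ⊆ᴿ H.R → H.R ⊆ᴿ G.R → P ⊆ᴿ P′
    P-from-edges R⊆R′ R′⊆R a b q with P′ a b in q′
    ... | true  = refl
    ... | false = ⊥-elim (false≢true (trans (sym (proj₂ (G.R-elim r))) q))
      where
      r = R′⊆R a b (H.R-intro (S-from-edges R⊆R′ a b (IsGarland.P⊆S g a b q)) q′)

  determined : ∀ {S P S′ P′} (g : IsGarland p E S P) (h : IsGarland p E S′ P′) →
    Garland.R g ⊆ᴿ Garland.R h → Garland.R h ⊆ᴿ Garland.R g → _≈G_ {n} (S , P) (S′ , P′)
  determined g h R⊆R′ R′⊆R a b =
      true-equiv (S-from-edges g h R⊆R′ a b) (S-from-edges h g R′⊆R a b)
    , true-equiv (P-from-edges g h R⊆R′ R′⊆R a b) (P-from-edges h g R′⊆R R⊆R′ a b)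

  encodeG : GarlandData n → Vec Bool (length edges)
  encodeG (S , P) = encode (edgeRel S P)

  encodeG-injective : ∀ {S P S′ P′} → IsGarland p E S P → IsGarland p E S′ P′ →
    encodeG (S , P) ≡ encodeG (S′ , P′) → _≈G_ {n} (S , P) (S′ , P′)
  encodeG-injective g h eq = determined g h
    (encode-reflects (Garland.R-sym g) (Garland.R-sym h) (Garland.R⊆E g) eq)
    (encode-reflects (Garland.R-sym h) (Garland.R-sym g) (Garland.R⊆E h) (sym eq))

  encodeG-nonzero : ∀ {S P} → IsGarland p E S P → isZero (encodeG (S , P)) ≡ false
  encodeG-nonzero g = let (a , b , r) = Garland.has-edge g
                      in encode-nonzero (Garland.R-sym g) (Garland.R⊆E g a b r) r

  encodeG-avoids-Xi2 : ∀ {x y z S P} → IsXi2 p E x y z → IsGarland p E S P →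
    covers (encode (xiEdges x y z)) (encodeG (S , P)) ≡ false
  encodeG-avoids-Xi2 {x} {y} {z} {S} {P} ξ g = ¬-not contains
    where
    open Xi2 ξ
    contains : covers (encode (xiEdges x y z)) (encodeG (S , P)) ≢ true
    contains cov = Garland.no-Xi2 g ξ (kept exy xi-xy) (kept eyz xi-yz)
      where
      kept : ∀ {a b} → E a b ≡ true → xiEdges x y z a b ≡ true → edgeRel S P a b ≡ true
      kept = encode-covers (xiEdges-sym x y z) (Garland.R-sym g) cov

  garlands-counted : ∀ {x₁ y₁ z₁ x₂ y₂ z₂} → IsXi2 p E x₁ y₁ z₁ → IsXi2 p E x₂ y₂ z₂ →
    GarlandsAtMost p E
      (count (length edges) (Avoids (encode (xiEdges x₁ y₁ z₁)) (encode (xiEdges x₂ y₂ z₂))))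
  garlands-counted {x₁} {y₁} {z₁} {x₂} {y₂} {z₂} ξ₁ ξ₂ L garlands distinct =
    subst (_≤ _) (length-map encodeG L)
      (pigeonhole _ _ (map encodeG L)
        (All.map⁺ (All.map avoids garlands))
        (map-distinct encodeG encodeG-injective garlands distinct))
    where
    avoids : ∀ {G} → IsGarland p E (proj₁ G) (proj₂ G) →
             Avoids (encode (xiEdges x₁ y₁ z₁)) (encode (xiEdges x₂ y₂ z₂)) (encodeG G) ≡ true
    avoids {S , P} g rewrite encodeG-nonzero g | encodeG-avoids-Xi2 ξ₁ g | encodeG-avoids-Xi2 ξ₂ g = refl

  one-Xi2-bound : ∀ {x y z} → IsXi2 p E x y z → GarlandsAtMost p E (3 * 2 ^ (countPairs n E ∸ 2) ∸ 1)
  one-Xi2-bound {x} {y} {z} ξ L garlands distinct =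
    subst (λ m → length L ≤ 3 * 2 ^ (m ∸ 2) ∸ 1) length-edges (≤-trans
      (garlands-counted ξ ξ L garlands distinct)
      (bound-one (length edges) (weight M) _ (weight-xiEdges x y z) (count-Avoids-one _ M (Xi2.xi-nonzero ξ))))
    where
    M = encode (xiEdges x y z)

  two-Xi2-bound : ∀ {x₁ y₁ z₁ x₂ y₂ z₂} → IsXi2 p E x₁ y₁ z₁ → IsXi2 p E x₂ y₂ z₂ →
    GarlandsAtMost p E
      (2 ^ (countPairs n E ∸ 1)
       + 2 ^ (countPairs n E ∸ countPairs n (λ a b → xiEdges x₁ y₁ z₁ a b ∨ xiEdges x₂ y₂ z₂ a b))
       ∸ 1)
  two-Xi2-bound {x₁} {y₁} {z₁} {x₂} {y₂} {z₂} ξ₁ ξ₂ L garlands distinct =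
    subst (λ m → length L ≤ 2 ^ (m ∸ 1) + 2 ^ (m ∸ countPairs n U) ∸ 1) length-edges (≤-trans
      (garlands-counted ξ₁ ξ₂ L garlands distinct)
      (bound-two (length edges) (weight M₁) (weight M₂) _ _
                 (weight-xiEdges x₁ y₁ z₁) (weight-xiEdges x₂ y₂ z₂)
        (trans (count-Avoids _ M₁ M₂ (Xi2.xi-nonzero ξ₁) (Xi2.xi-nonzero ξ₂))
               (cong (λ k → 2 ^ length edges + 2 ^ (length edges ∸ k)) weight-union))))
    where
    M₁ = encode (xiEdges x₁ y₁ z₁)
    M₂ = encode (xiEdges x₂ y₂ z₂)
    U : Rel₂ n
    U a b = xiEdges x₁ y₁ z₁ a b ∨ xiEdges x₂ y₂ z₂ a b
    weight-union : weight (zipWith _∨_ M₁ M₂) ≡ countPairs n U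
    weight-union = trans
      (cong weight (zipWith-∨-map (at (xiEdges x₁ y₁ z₁)) (at (xiEdges x₂ y₂ z₂)) (fromList edges)))
      (weight-encode U (∨-⊆ᴿ (Xi2.xi⊆E ξ₁) (Xi2.xi⊆E ξ₂)))

lemma6 : (t n : ℕ) (p : Fin n → Fin t) → Surjective p →
         (E : Rel₂ n) → IsEdgeSet p E →
         ((x y z : Fin n) → IsXi2 p E x y z →
            GarlandsAtMost p E (3 * 2 ^ (countPairs n E ∸ 2) ∸ 1))
         ×
         ((x₁ y₁ z₁ x₂ y₂ z₂ : Fin n) → IsXi2 p E x₁ y₁ z₁ → IsXi2 p E x₂ y₂ z₂ →
            ¬ ((a b : Fin n) → xiEdges x₁ y₁ z₁ a b ≡ xiEdges x₂ y₂ z₂ a b) →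
            GarlandsAtMost p E
              (2 ^ (countPairs n E ∸ 1)
               + 2 ^ (countPairs n E ∸ countPairs n (λ a b → xiEdges x₁ y₁ z₁ a b ∨ xiEdges x₂ y₂ z₂ a b))
               ∸ 1))
lemma6 t n p _ E isE =
    (λ _ _ _ ξ → one-Xi2-bound ξ)
  , (λ _ _ _ _ _ _ ξ₁ ξ₂ _ → two-Xi2-bound ξ₁ ξ₂)
  where open Garlands p E isE
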